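{- Let $\{a,b,c,d,e\}$ be a Diophantine quintuple with $a<b<c<d<e$, and let $x,y,z,X,Y,Z,W$ be the positive integers with $ad+1=x^2$, $bd+1=y^2$, $cd+1=z^2$, $ae+1=X^2$, $be+1=Y^2$, $ce+1=Z^2$, $de+1=W^2$. Suppose $\varepsilon\in\{1,-1\}$ and nonnegative integers $l,m,n$ satisfy $W\sqrt a+X\sqrt d=(\varepsilon\sqrt a+\sqrt d)(x+\sqrt{ad})^{2l}$, $W\sqrt b+Y\sqrt d=(\varepsilon\sqrt b+\sqrt d)(y+\sqrt{bd})^{2m}$ and $W\sqrt c+Z\sqrt d=(\varepsilon\sqrt c+\sqrt d)(z+\sqrt{cd})^{2n}$. Then $2l\le 3m$, and $m<l$ unless $m=0$.
   Context: A Diophantine $m$-tuple is a set of $m$ distinct positive integers such that the product of any two of them increased by $1$ is a perfect square. -}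

module Defs where

open import Data.Nat using (ℕ; zero; suc; _<_)
open import Data.Integer as ℤ using (ℤ; +_; _+_; _*_; 1ℤ; 0ℤ)
open import Data.Product using (_×_; _,_; ∃)
open import Data.List using (List)
open import Data.List.Relation.Unary.All using (All)
open import Data.List.Relation.Unary.Unique.Propositional using (Unique)
open import Data.List.Membership.Propositional using (_∈_)
open import Relation.Binary.PropositionalEquality using (_≡_; _≢_)

IsSquare : ℕ → Set
IsSquare n = ∃ λ k → k Data.Nat.* k ≡ n

DiophantineTuple : List ℕ → Set
DiophantineTuple s =
  All (λ x → 0 < x) s × Unique s ×
  (∀ {i j} → i ∈ s → j ∈ s → i ≢ j → IsSquare (i Data.Nat.* j Data.Nat.+ 1))

-- Elements u + v √D of ℤ[√D] represented as pairs (u , v).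
mulQ : ℤ → ℤ × ℤ → ℤ × ℤ → ℤ × ℤ
mulQ D (u , v) (u' , v') = (u * u' + D * v * v' , u * v' + v * u')

powQ : ℤ → ℤ → ℕ → ℤ × ℤ
powQ D x zero    = (1ℤ , 0ℤ)
powQ D x (suc k) = mulQ D (powQ D x k) (x , 1ℤ)

-- PowerEq ε a d x W X k expresses
--   W √a + X √d = (ε √a + √d) (x + √(ad))^k .
-- Writing (x + √(ad))^k = u + v √(ad), the right side equals
--   (ε u + v d) √a + (ε v a + u) √d,
-- and since √a, √d are linearly independent over ℚ (ad + 1 = x², so ad
-- is not a square) the identity is equivalent to comparing coefficients.
PowerEq : ℤ → ℕ → ℕ → ℕ → ℕ → ℕ → ℕ → Set
PowerEq ε a d x W X k with powQ (+ a * + d) (+ x) k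
... | (u , v) = (+ W ≡ ε * u + v * + d) × (+ X ≡ ε * v * + a + u)

-- Multiplication by
-- x + √(pd) sends (W, X) to (xW + dX, pW + xX); after one such step the pair is natural and
-- satisfies pW ≤ xX and dX ≤ xW (because pd < x²), so every further double step multiplies W
-- by a factor between 4pd + 1 and 4pd + 3.  As 4ad + 3 ≤ 4bd + 1, the W-sequence of a stays
-- below that of b, hence a common value W forces m < l.  The sequence of a grows at least like
-- (4d)^l and that of b at most like (4bd + 3)^m ≤ (4d)^(3m/2), which gives 2l ≤ 3m once
-- d ≥ 4bc ≥ b².  That bound is the classical descent for a Diophantine triple {p, q, s} with
-- pq + 1 = r²: the companion s' = p + q + s + 2pqs − 2√((pq+1)(ps+1)(qs+1)) is a natural
-- number with ps' + 1 and qs' + 1 square and s = p + q + s'(1 + 2pq) + 2r√((ps'+1)(qs'+1)),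
-- so s = p + q + 2r or s ≥ 4pq; for {b, c, d} and {a, c, d} only d ≥ 4bc survives.

module Submission where

open import Defs
open import Data.Empty using (⊥; ⊥-elim)
open import Data.List using (_∷_; [])
import Data.List.Relation.Unary.All as All
open import Data.List.Relation.Unary.Any using (here; there)
open import Data.Product using (_×_; _,_; proj₁; proj₂; ∃)
open import Data.Sum using (_⊎_; inj₁; inj₂; [_,_]′)
open import Data.Integer as ℤ using (ℤ; +_; -[1+_]; 1ℤ; -1ℤ; 0ℤ)
open import Function using (_∘_; id)
open import Relation.Binary.PropositionalEquality

module ℤ-Algebra where
  open import Data.Integer using (_+_; _*_; _-_; -_)
  open import Data.Integer.Tactic.RingSolver using (solve; solve-∀)
  open ≡-Reasoning

  -- the coefficients, in the basis √p, √d, of (w √p + χ √d)(x + √(pd))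
  halfStepℤ : (p d x : ℤ) → ℤ × ℤ → ℤ × ℤ
  halfStepℤ p d x (w , χ) = x * w + d * χ , p * w + x * χ

  -- the coefficients, in the basis √p, √d, of (ε √p + √d)(u + v √(pd))
  mixedCoeffs : (p d ε : ℤ) → ℤ × ℤ → ℤ × ℤ
  mixedCoeffs p d ε (u , v) = ε * u + v * d , ε * v * p + u

  mixedCoeffs-mulQ : ∀ p d x ε uv →
    mixedCoeffs p d ε (mulQ (p * d) uv (x , 1ℤ)) ≡ halfStepℤ p d x (mixedCoeffs p d ε uv)
  mixedCoeffs-mulQ p d x ε (u , v) = cong₂ _,_ √p-part √d-part
    where
    √p-part : ε * (u * x + p * d * v * 1ℤ) + (u * 1ℤ + v * x) * d ≡ x * (ε * u + v * d) + d * (ε * v * p + u)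
    √p-part = solve (p ∷ d ∷ x ∷ ε ∷ u ∷ v ∷ [])
    √d-part : ε * (u * 1ℤ + v * x) * p + (u * x + p * d * v * 1ℤ) ≡ p * (ε * u + v * d) + x * (ε * v * p + u)
    √d-part = solve (p ∷ d ∷ x ∷ ε ∷ u ∷ v ∷ [])

  mixedCoeffs-one : ∀ p d ε → mixedCoeffs p d ε (1ℤ , 0ℤ) ≡ (ε , 1ℤ)
  mixedCoeffs-one p d ε = cong₂ _,_ (solve (d ∷ ε ∷ [])) (solve (p ∷ ε ∷ []))

  i*-1+j*1≡j-i : ∀ i j → i * -1ℤ + j * 1ℤ ≡ j - i
  i*-1+j*1≡j-i = solve-∀

  i*-j+1+i*j≡1 : ∀ i j → i * - j + 1ℤ + i * j ≡ 1ℤ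
  i*-j+1+i*j≡1 = solve-∀

  -- d₋ of the Diophantine triple {p, q, s} with roots r, σ, τ; s is in turn d₊ of {p, q, companion}
  companion : (p q s r σ τ : ℤ) → ℤ
  companion p q s r σ τ = p + q + s + + 2 * p * q * s - + 2 * r * σ * τ

  module Companion {p q s r σ τ : ℤ}
           (hr : p * q + 1ℤ ≡ r * r) (hσ : p * s + 1ℤ ≡ σ * σ) (hτ : q * s + 1ℤ ≡ τ * τ) where

    companion-square₁ : p * companion p q s r σ τ + 1ℤ ≡ (r * σ - p * τ) * (r * σ - p * τ)
    companion-square₁ = begin
      p * (p + q + s + + 2 * p * q * s - + 2 * r * σ * τ) + 1ℤ
        ≡⟨ solve (p ∷ q ∷ s ∷ r ∷ σ ∷ τ ∷ []) ⟩
      (p * q + 1ℤ) * (p * s + 1ℤ) + p * p * (q * s + 1ℤ) - + 2 * p * r * σ * τ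
        ≡⟨ cong₂ (λ r² σ² → r² * σ² + p * p * (q * s + 1ℤ) - + 2 * p * r * σ * τ) hr hσ ⟩
      r * r * (σ * σ) + p * p * (q * s + 1ℤ) - + 2 * p * r * σ * τ
        ≡⟨ cong (λ τ² → r * r * (σ * σ) + p * p * τ² - + 2 * p * r * σ * τ) hτ ⟩
      r * r * (σ * σ) + p * p * (τ * τ) - + 2 * p * r * σ * τ
        ≡⟨ solve (p ∷ q ∷ s ∷ r ∷ σ ∷ τ ∷ []) ⟩
      (r * σ - p * τ) * (r * σ - p * τ) ∎

    companion-square₂ : q * companion p q s r σ τ + 1ℤ ≡ (r * τ - q * σ) * (r * τ - q * σ)
    companion-square₂ = begin
      q * (p + q + s + + 2 * p * q * s - + 2 * r * σ * τ) + 1ℤ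
        ≡⟨ solve (p ∷ q ∷ s ∷ r ∷ σ ∷ τ ∷ []) ⟩
      (p * q + 1ℤ) * (q * s + 1ℤ) + q * q * (p * s + 1ℤ) - + 2 * q * r * σ * τ
        ≡⟨ cong₂ (λ r² τ² → r² * τ² + q * q * (p * s + 1ℤ) - + 2 * q * r * σ * τ) hr hτ ⟩
      r * r * (τ * τ) + q * q * (p * s + 1ℤ) - + 2 * q * r * σ * τ
        ≡⟨ cong (λ σ² → r * r * (τ * τ) + q * q * σ² - + 2 * q * r * σ * τ) hσ ⟩
      r * r * (τ * τ) + q * q * (σ * σ) - + 2 * q * r * σ * τ
        ≡⟨ solve (p ∷ q ∷ s ∷ r ∷ σ ∷ τ ∷ []) ⟩
      (r * τ - q * σ) * (r * τ - q * σ) ∎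

    companion-sum : p + q + companion p q s r σ τ * (1ℤ + + 2 * p * q) + + 2 * r * (r * σ - p * τ) * (r * τ - q * σ) ≡ s
    companion-sum = begin
      p + q + (p + q + s + + 2 * p * q * s - + 2 * r * σ * τ) * (1ℤ + + 2 * p * q) + + 2 * r * (r * σ - p * τ) * (r * τ - q * σ)
        ≡⟨ solve (p ∷ q ∷ s ∷ r ∷ σ ∷ τ ∷ []) ⟩
      p + q + (p + q + s + + 2 * p * q * s) * (1ℤ + + 2 * p * q) - + 2 * r * σ * τ * (1ℤ + + 2 * p * q)
        + + 2 * (r * r) * (r * σ * τ) - + 2 * q * (r * r) * (σ * σ) - + 2 * p * (r * r) * (τ * τ) + + 2 * p * q * (r * σ * τ)
        ≡⟨ cong (λ r² → p + q + (p + q + s + + 2 * p * q * s) * (1ℤ + + 2 * p * q) - + 2 * r * σ * τ * (1ℤ + + 2 * p * q)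
                        + + 2 * r² * (r * σ * τ) - + 2 * q * r² * (σ * σ) - + 2 * p * r² * (τ * τ) + + 2 * p * q * (r * σ * τ))
                (sym hr) ⟩
      p + q + (p + q + s + + 2 * p * q * s) * (1ℤ + + 2 * p * q) - + 2 * r * σ * τ * (1ℤ + + 2 * p * q)
        + + 2 * (p * q + 1ℤ) * (r * σ * τ) - + 2 * q * (p * q + 1ℤ) * (σ * σ) - + 2 * p * (p * q + 1ℤ) * (τ * τ) + + 2 * p * q * (r * σ * τ)
        ≡⟨ cong₂ (λ σ² τ² → p + q + (p + q + s + + 2 * p * q * s) * (1ℤ + + 2 * p * q) - + 2 * r * σ * τ * (1ℤ + + 2 * p * q)
                        + + 2 * (p * q + 1ℤ) * (r * σ * τ) - + 2 * q * (p * q + 1ℤ) * σ² - + 2 * p * (p * q + 1ℤ) * τ² + + 2 * p * q * (r * σ * τ))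
                 (sym hσ) (sym hτ) ⟩
      p + q + (p + q + s + + 2 * p * q * s) * (1ℤ + + 2 * p * q) - + 2 * r * σ * τ * (1ℤ + + 2 * p * q)
        + + 2 * (p * q + 1ℤ) * (r * σ * τ) - + 2 * q * (p * q + 1ℤ) * (p * s + 1ℤ) - + 2 * p * (p * q + 1ℤ) * (q * s + 1ℤ) + + 2 * p * q * (r * σ * τ)
        ≡⟨ solve (p ∷ q ∷ s ∷ r ∷ σ ∷ τ ∷ []) ⟩
      s ∎

open ℤ-Algebra

open import Data.Nat using (ℕ; zero; suc; _+_; _*_; _^_; _∸_; _≤_; _<_; z≤n; s≤s; z<s; s≤s⁻¹; NonZero; >-nonZero)
open import Data.Nat.Properties
open import Algebra.Properties.CommutativeSemigroup +-commutativeSemigroup using () renaming (interchange to +-interchange)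
open import Data.Nat.Tactic.RingSolver using (solve; solve-∀)
import Data.Integer.Properties as ℤₚ

m*m<n*n⇒m<n : ∀ {m n} → m * m < n * n → m < n
m*m<n*n⇒m<n m*m<n*n = ≰⇒> λ n≤m → <⇒≱ m*m<n*n (*-mono-≤ n≤m n≤m)

m*m≤n*n⇒m≤n : ∀ {m n} → m * m ≤ n * n → m ≤ n
m*m≤n*n⇒m≤n m*m≤n*n = ≮⇒≥ λ n<m → <⇒≱ (*-mono-< n<m n<m) m*m≤n*n

[m*n]*[m*n]≡[m*m]*[n*n] : ∀ m n → m * n * (m * n) ≡ m * m * (n * n)
[m*n]*[m*n]≡[m*m]*[n*n] = solve-∀

rearrangement-< : ∀ {a b u v} → a < b → u < v → a * v + b * u < a * u + b * v
rearrangement-< {a} {u = u} a<b u<v with m≤n⇒∃[o]m+o≡n a<b | m≤n⇒∃[o]m+o≡n u<v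
... | t , refl | e , refl = subst (a * (suc u + e) + (suc a + t) * u <_) excess (m<m+n _ z<s)
  where
  excess : a * (suc u + e) + (suc a + t) * u + suc t * suc e ≡ a * u + (suc a + t) * (suc u + e)
  excess = solve (a ∷ u ∷ t ∷ e ∷ [])

-- Growth of sequences

module _ (f : ℕ → ℕ) where

  ≤-by-steps : (∀ k → f k ≤ f (suc k)) → ∀ {m n} → m ≤ n → f m ≤ f n
  ≤-by-steps step {n = zero}  z≤n = ≤-refl
  ≤-by-steps step {m} {suc n} m≤1+n with m≤n⇒m<n∨m≡n m≤1+n
  ... | inj₁ m<1+n = ≤-trans (≤-by-steps step (s≤s⁻¹ m<1+n)) (step n)
  ... | inj₂ refl  = ≤-refl

  geometric-lower-bound : ∀ {r} → (∀ k → r * f k ≤ f (suc k)) → ∀ k → r ^ k * f 0 ≤ f k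
  geometric-lower-bound step zero    = ≤-reflexive (*-identityˡ (f 0))
  geometric-lower-bound {r} step (suc k) = begin
    r * r ^ k * f 0   ≡⟨ *-assoc r (r ^ k) (f 0) ⟩
    r * (r ^ k * f 0) ≤⟨ *-monoʳ-≤ r (geometric-lower-bound step k) ⟩
    r * f k           ≤⟨ step k ⟩
    f (suc k)         ∎
    where open ≤-Reasoning

  geometric-upper-bound : ∀ {r} → (∀ k → f (suc k) ≤ r * f k) → ∀ k → f k ≤ r ^ k * f 0
  geometric-upper-bound step zero    = ≤-reflexive (sym (*-identityˡ (f 0)))
  geometric-upper-bound {r} step (suc k) = begin
    f (suc k)         ≤⟨ step k ⟩
    r * f k           ≤⟨ *-monoʳ-≤ r (geometric-upper-bound step k) ⟩
    r * (r ^ k * f 0) ≡⟨ *-assoc r (r ^ k) (f 0) ⟨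
    r * r ^ k * f 0   ∎
    where open ≤-Reasoning

module _ {f g : ℕ → ℕ} {r : ℕ} .{{_ : NonZero r}}
         (f-step : ∀ k → f (suc k) ≤ r * f k) (g-step : ∀ k → r * g k ≤ g (suc k)) (f₀<g₀ : f 0 < g 0) where

  slower-below : ∀ k → f k < g k
  slower-below zero    = f₀<g₀
  slower-below (suc k) = begin-strict
    f (suc k) ≤⟨ f-step k ⟩
    r * f k   <⟨ *-monoʳ-< r (slower-below k) ⟩
    r * g k   ≤⟨ g-step k ⟩
    g (suc k) ∎
    where open ≤-Reasoning

  meeting-index-< : ∀ {l m} → f l ≡ g m → m < l
  meeting-index-< {l} {m} fl≡gm = ≰⇒> λ l≤m → <-irrefl fl≡gm (begin-strict
    f l <⟨ slower-below l ⟩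
    g l ≤⟨ ≤-by-steps g (λ k → ≤-trans (m≤n*m (g k) r) (g-step k)) l≤m ⟩
    g m ∎)
    where open ≤-Reasoning

growth-gap : ∀ {A B u v w l m} → B ^ 2 ≤ A ^ 3 → v < A * u → A ^ l * u ≤ w → w ≤ B ^ m * v →
             2 * suc l ≤ 3 * suc m
growth-gap {zero} _ ()
growth-gap {A@(suc _)} {B} {u} {v} {w} {l} {m} B²≤A³ v<Au lower upper =
  ≮⇒≥ λ 3M<2L → <-irrefl refl (w*w<w*w (exponent-gap 3M<2L))
  where
  open ≤-Reasoning
  exponent-gap : 3 * suc m < 2 * suc l → 3 * m + 2 ≤ 2 * l
  exponent-gap 3M<2L = +-cancelʳ-≤ 2 (3 * m + 2) (2 * l) (subst₂ _≤_ 3M+1≡ 2L≡ 3M<2L)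
    where
    3M+1≡ : suc (3 * suc m) ≡ 3 * m + 2 + 2
    3M+1≡ = solve (m ∷ [])
    2L≡ : 2 * suc l ≡ 2 * l + 2
    2L≡ = solve (l ∷ [])
  regroup : ∀ i j k → i * (j * k * (j * k)) ≡ i * (j * (j * 1)) * (k * k)
  regroup = solve-∀
  square-pow : ∀ C k → C ^ k * C ^ k ≡ C ^ (2 * k)
  square-pow C k = begin-equality
    C ^ k * C ^ k ≡⟨ cong (C ^ k *_) (*-identityʳ (C ^ k)) ⟨
    (C ^ k) ^ 2   ≡⟨ ^-*-assoc C k 2 ⟩
    C ^ (k * 2)   ≡⟨ cong (C ^_) (*-comm k 2) ⟩
    C ^ (2 * k)   ∎
  w*w<w*w : 3 * m + 2 ≤ 2 * l → w * w < w * w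
  w*w<w*w 3m+2≤2l = begin-strict
    w * w                                ≤⟨ *-mono-≤ upper upper ⟩
    B ^ m * v * (B ^ m * v)              ≡⟨ [m*n]*[m*n]≡[m*m]*[n*n] (B ^ m) v ⟩
    B ^ m * B ^ m * (v * v)              ≡⟨ cong (_* (v * v)) (trans (square-pow B m) (sym (^-*-assoc B 2 m))) ⟩
    (B ^ 2) ^ m * (v * v)                ≤⟨ *-monoˡ-≤ (v * v) (^-monoˡ-≤ m B²≤A³) ⟩
    (A ^ 3) ^ m * (v * v)                ≡⟨ cong (_* (v * v)) (^-*-assoc A 3 m) ⟩
    A ^ (3 * m) * (v * v)                <⟨ *-monoʳ-< (A ^ (3 * m)) {{m^n≢0 A (3 * m)}} (*-mono-< v<Au v<Au) ⟩
    A ^ (3 * m) * (A * u * (A * u))      ≡⟨ regroup (A ^ (3 * m)) A u ⟩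
    A ^ (3 * m) * A ^ 2 * (u * u)        ≡⟨ cong (_* (u * u)) (^-distribˡ-+-* A (3 * m) 2) ⟨
    A ^ (3 * m + 2) * (u * u)            ≤⟨ *-monoˡ-≤ (u * u) (^-monoʳ-≤ A 3m+2≤2l) ⟩
    A ^ (2 * l) * (u * u)                ≡⟨ cong (_* (u * u)) (square-pow A l) ⟨
    A ^ l * A ^ l * (u * u)              ≡⟨ [m*n]*[m*n]≡[m*m]*[n*n] (A ^ l) u ⟨
    A ^ l * u * (A ^ l * u)              ≤⟨ *-mono-≤ lower lower ⟩
    w * w                                ∎

-- Diophantine triples

pos-*+1 : ∀ a b → + (a * b + 1) ≡ + a ℤ.* + b ℤ.+ 1ℤ
pos-*+1 a b = cong (ℤ._+ 1ℤ) (ℤₚ.pos-* a b)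

pos-*+* : ∀ a b c e → + (a * b + c * e) ≡ + a ℤ.* + b ℤ.+ + c ℤ.* + e
pos-*+* a b c e = cong₂ ℤ._+_ (ℤₚ.pos-* a b) (ℤₚ.pos-* c e)

pos-*∸* : ∀ a b c e → c * e ≤ a * b → + (a * b ∸ c * e) ≡ + a ℤ.* + b ℤ.- + c ℤ.* + e
pos-*∸* a b c e ce≤ab = begin
  + (a * b ∸ c * e)          ≡⟨ ℤₚ.⊖-≥ ce≤ab ⟨
  (a * b) ℤ.⊖ (c * e)        ≡⟨ ℤₚ.m-n≡m⊖n (a * b) (c * e) ⟨
  + (a * b) ℤ.- + (c * e)    ≡⟨ cong₂ ℤ._-_ (ℤₚ.pos-* a b) (ℤₚ.pos-* c e) ⟩
  + a ℤ.* + b ℤ.- + c ℤ.* + e ∎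
  where open ≡-Reasoning

toℤ-square-eq : ∀ a b c → a * b + 1 ≡ c * c → + a ℤ.* + b ℤ.+ 1ℤ ≡ + c ℤ.* + c
toℤ-square-eq a b c eq = trans (sym (pos-*+1 a b)) (trans (cong +_ eq) (ℤₚ.pos-* c c))

fromℤ-square-eq : ∀ a b c → + a ℤ.* + b ℤ.+ 1ℤ ≡ + c ℤ.* + c → a * b + 1 ≡ c * c
fromℤ-square-eq a b c eq = ℤₚ.+-injective (trans (pos-*+1 a b) (trans eq (sym (ℤₚ.pos-* c c))))

pos-*-* : ∀ a b c → + (a * b * c) ≡ + a ℤ.* + b ℤ.* + c
pos-*-* a b c = trans (ℤₚ.pos-* (a * b) c) (cong (ℤ._* + c) (ℤₚ.pos-* a b))

pos-*-*-* : ∀ a b c e → + (a * b * c * e) ≡ + a ℤ.* + b ℤ.* + c ℤ.* + e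
pos-*-*-* a b c e = trans (ℤₚ.pos-* (a * b * c) e) (cong (ℤ._* + e) (pos-*-* a b c))

mixed-product-< : ∀ {p q s r σ τ} → p ≤ q →
                  p * q + 1 ≡ r * r → p * s + 1 ≡ σ * σ → q * s + 1 ≡ τ * τ → p * τ < r * σ
mixed-product-< {p} {q} {s} {r} {σ} {τ} p≤q hr hσ hτ = m*m<n*n⇒m<n (begin-strict
  p * τ * (p * τ)                     ≡⟨ [m*n]*[m*n]≡[m*m]*[n*n] p τ ⟩
  p * p * (τ * τ)                     ≡⟨ cong (p * p *_) hτ ⟨
  p * p * (q * s + 1)                 ≡⟨ solve (p ∷ q ∷ s ∷ []) ⟩
  p * p * q * s + p * p               <⟨ +-monoʳ-< (p * p * q * s) pp<pq+ps+1 ⟩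
  p * p * q * s + (p * q + p * s + 1) ≡⟨ solve (p ∷ q ∷ s ∷ []) ⟩
  (p * q + 1) * (p * s + 1)           ≡⟨ cong₂ _*_ hr hσ ⟩
  r * r * (σ * σ)                     ≡⟨ [m*n]*[m*n]≡[m*m]*[n*n] r σ ⟨
  r * σ * (r * σ)                     ∎)
  where
  open ≤-Reasoning
  pp<pq+ps+1 : p * p < p * q + p * s + 1
  pp<pq+ps+1 = ≤-<-trans (≤-trans (*-monoʳ-≤ p p≤q) (m≤m+n (p * q) (p * s))) (m<m+n _ z<s)

regular⊎large : ∀ {p q s r A B} n → p * q + 1 ≡ r * r → p * n + 1 ≡ A * A → q * n + 1 ≡ B * B →
                p + q + n * (1 + 2 * p * q) + 2 * r * A * B ≡ s → s ≡ p + q + 2 * r ⊎ 4 * p * q ≤ s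
regular⊎large {p} {q} {s} {r} {A} {B} zero _ hA hB hs = inj₁ (begin
  s                                          ≡⟨ hs ⟨
  p + q + 0 * (1 + 2 * p * q) + 2 * r * A * B ≡⟨ cong₂ (λ α β → p + q + 0 + 2 * r * α * β) (unit p hA) (unit q hB) ⟩
  p + q + 0 + 2 * r * 1 * 1                  ≡⟨ solve (p ∷ q ∷ r ∷ []) ⟩
  p + q + 2 * r                              ∎)
  where
  open ≡-Reasoning
  unit : ∀ a {C} → a * 0 + 1 ≡ C * C → C ≡ 1
  unit a {C} eq = m*n≡1⇒n≡1 C C (trans (sym eq) (cong (_+ 1) (*-zeroʳ a)))
regular⊎large {p} {q} {s} {r} {A} {B} (suc k) hr hA hB hs = inj₂ (begin
  4 * p * q                                           ≡⟨ solve (p ∷ q ∷ []) ⟩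
  2 * p * q + 2 * (p * q)                             ≤⟨ +-mono-≤ 2pq≤[1+k][1+2pq] (*-monoʳ-≤ 2 pq≤rAB) ⟩
  suc k * (1 + 2 * p * q) + 2 * (r * A * B)           ≤⟨ m≤n+m _ (p + q) ⟩
  p + q + (suc k * (1 + 2 * p * q) + 2 * (r * A * B)) ≡⟨ solve (p ∷ q ∷ k ∷ r ∷ A ∷ B ∷ []) ⟩
  p + q + suc k * (1 + 2 * p * q) + 2 * r * A * B     ≡⟨ hs ⟩
  s                                                   ∎)
  where
  open ≤-Reasoning
  2pq≤[1+k][1+2pq] : 2 * p * q ≤ suc k * (1 + 2 * p * q)
  2pq≤[1+k][1+2pq] = ≤-trans (n≤1+n (2 * p * q)) (m≤n*m (1 + 2 * p * q) (suc k))
  pq≤rAB : p * q ≤ r * A * B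
  pq≤rAB = m*m≤n*n⇒m≤n (begin
    p * q * (p * q)                                   ≤⟨ *-monoˡ-≤ (p * q) (m≤m+n (p * q) 1) ⟩
    (p * q + 1) * (p * q)                             ≤⟨ *-monoʳ-≤ (p * q + 1) (*-mono-≤ (a≤a[1+k]+1 p) (a≤a[1+k]+1 q)) ⟩
    (p * q + 1) * ((p * suc k + 1) * (q * suc k + 1)) ≡⟨ cong₂ _*_ hr (cong₂ _*_ hA hB) ⟩
    r * r * (A * A * (B * B))                         ≡⟨ solve (r ∷ A ∷ B ∷ []) ⟩
    r * A * B * (r * A * B)                           ∎)
    where
    a≤a[1+k]+1 : ∀ a → a ≤ a * suc k + 1
    a≤a[1+k]+1 a = ≤-trans (m≤m*n a (suc k)) (m≤m+n (a * suc k) 1)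

companion-cases : ∀ {p q s r A B} c → 2 ≤ q → p * q + 1 ≡ r * r →
                  + p ℤ.* c ℤ.+ 1ℤ ≡ + A ℤ.* + A → + q ℤ.* c ℤ.+ 1ℤ ≡ + B ℤ.* + B →
                  + p ℤ.+ + q ℤ.+ c ℤ.* (1ℤ ℤ.+ + 2 ℤ.* + p ℤ.* + q) ℤ.+ + 2 ℤ.* + r ℤ.* + A ℤ.* + B ≡ + s →
                  s ≡ p + q + 2 * r ⊎ 4 * p * q ≤ s
companion-cases {p} {q} {s} {r} {A} {B} (+ n) _ hr square₁ square₂ sum =
  regular⊎large {p} {q} {s} {r} {A} {B} n hr
    (fromℤ-square-eq p n A square₁) (fromℤ-square-eq q n B square₂) (ℤₚ.+-injective (trans cast sum))
  where
  cast : + (p + q + n * (1 + 2 * p * q) + 2 * r * A * B)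
         ≡ + p ℤ.+ + q ℤ.+ + n ℤ.* (1ℤ ℤ.+ + 2 ℤ.* + p ℤ.* + q) ℤ.+ + 2 ℤ.* + r ℤ.* + A ℤ.* + B
  cast = cong₂ (λ α β → + p ℤ.+ + q ℤ.+ α ℤ.+ β)
               (trans (ℤₚ.pos-* n (1 + 2 * p * q)) (cong (λ γ → + n ℤ.* (1ℤ ℤ.+ γ)) (pos-*-* 2 p q)))
               (pos-*-*-* 2 r A B)
companion-cases {q = q} {B = B} -[1+ k ] 2≤q _ _ square₂ _ =
  ⊥-elim (<⇒≱ 2≤B²+q[1+k] (≤-reflexive (ℤₚ.+-injective B²+q[1+k]≡1)))
  where
  B²+q[1+k]≡1 : + (B * B + q * suc k) ≡ 1ℤ
  B²+q[1+k]≡1 = begin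
    + (B * B + q * suc k)                       ≡⟨ pos-*+* B B q (suc k) ⟩
    + B ℤ.* + B ℤ.+ + q ℤ.* + suc k             ≡⟨ cong (ℤ._+ + q ℤ.* + suc k) square₂ ⟨
    + q ℤ.* -[1+ k ] ℤ.+ 1ℤ ℤ.+ + q ℤ.* + suc k ≡⟨ i*-j+1+i*j≡1 (+ q) (+ suc k) ⟩
    1ℤ                                          ∎
    where open ≡-Reasoning
  2≤B²+q[1+k] : 2 ≤ B * B + q * suc k
  2≤B²+q[1+k] = ≤-trans 2≤q (≤-trans (m≤m*n q (suc k)) (m≤n+m (q * suc k) (B * B)))

s≡p+q+2r⊎4pq≤s : ∀ {p q s r σ τ} → 1 ≤ p → p < q → q < s →
                 p * q + 1 ≡ r * r → p * s + 1 ≡ σ * σ → q * s + 1 ≡ τ * τ → s ≡ p + q + 2 * r ⊎ 4 * p * q ≤ s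
s≡p+q+2r⊎4pq≤s {p} {q} {s} {r} {σ} {τ} 1≤p p<q q<s hr hσ hτ =
  companion-cases {p} {q} {s} {r} {r * σ ∸ p * τ} {r * τ ∸ q * σ} c (≤-trans (s≤s 1≤p) p<q) hr
    (subst (λ α → + p ℤ.* c ℤ.+ 1ℤ ≡ α ℤ.* α) (sym +A) companion-square₁)
    (subst (λ β → + q ℤ.* c ℤ.+ 1ℤ ≡ β ℤ.* β) (sym +B) companion-square₂)
    (subst₂ (λ α β → + p ℤ.+ + q ℤ.+ c ℤ.* (1ℤ ℤ.+ + 2 ℤ.* + p ℤ.* + q) ℤ.+ + 2 ℤ.* + r ℤ.* α ℤ.* β ≡ + s)
            (sym +A) (sym +B) companion-sum)
  where
  open Companion {+ p} {+ q} {+ s} {+ r} {+ σ} {+ τ}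
         (toℤ-square-eq p q r hr) (toℤ-square-eq p s σ hσ) (toℤ-square-eq q s τ hτ)
  c = companion (+ p) (+ q) (+ s) (+ r) (+ σ) (+ τ)
  +A : + (r * σ ∸ p * τ) ≡ + r ℤ.* + σ ℤ.- + p ℤ.* + τ
  +A = pos-*∸* r σ p τ (<⇒≤ (mixed-product-< {p} {q} {s} {r} {σ} {τ} (<⇒≤ p<q) hr hσ hτ))
  +B : + (r * τ ∸ q * σ) ≡ + r ℤ.* + τ ℤ.- + q ℤ.* + σ
  +B = pos-*∸* r τ q σ (<⇒≤ (subst (q * σ <_) (*-comm τ r) (mixed-product-< {q} {s} {p} {τ} {r} {σ} (<⇒≤ q<s) hτ
         (trans (cong (_+ 1) (*-comm q p)) hr) (trans (cong (_+ 1) (*-comm s p)) hσ))))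

4bc≤d : ∀ {a b c d} → 1 ≤ a → a < b → b < c → c < d →
        IsSquare (a * c + 1) → IsSquare (b * c + 1) →
        IsSquare (a * d + 1) → IsSquare (b * d + 1) → IsSquare (c * d + 1) → 4 * b * c ≤ d
4bc≤d {a} {b} {c} {d} 1≤a a<b b<c c<d (u , u²) (t , t²) (x , x²) (y , y²) (z , z²) =
  [ ⊥-elim ∘ not-regular , id ]′ (s≡p+q+2r⊎4pq≤s {b} {c} {d} {t} {y} {z} (≤-trans 1≤a (<⇒≤ a<b)) b<c c<d ht hy hz)
  where
  hu = sym u²
  ht = sym t²
  hx = sym x²
  hy = sym y²
  hz = sym z²
  open ≤-Reasoning
  u<t : u < t
  u<t = m*m<n*n⇒m<n (begin-strict
    u * u     ≡⟨ hu ⟨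
    a * c + 1 <⟨ +-monoˡ-< 1 (*-monoˡ-< c {{>-nonZero (≤-<-trans z≤n b<c)}} a<b) ⟩
    b * c + 1 ≡⟨ ht ⟩
    t * t     ∎)
  t≤c : t ≤ c
  t≤c = m*m≤n*n⇒m≤n (begin
    t * t     ≡⟨ ht ⟨
    b * c + 1 ≤⟨ +-monoʳ-≤ (b * c) (≤-trans (s≤s z≤n) b<c) ⟩
    b * c + c ≡⟨ +-comm (b * c) c ⟩
    suc b * c ≤⟨ *-monoˡ-≤ c b<c ⟩
    c * c     ∎)
  b+c+2t<4ac : b + c + 2 * t < 4 * a * c
  b+c+2t<4ac = begin-strict
    b + c + 2 * t <⟨ +-mono-<-≤ (+-monoˡ-< c b<c) (*-monoʳ-≤ 2 t≤c) ⟩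
    c + c + 2 * c ≡⟨ solve (c ∷ []) ⟩
    4 * 1 * c     ≤⟨ *-monoˡ-≤ c (*-monoʳ-≤ 4 1≤a) ⟩
    4 * a * c     ∎
  not-regular : d ≡ b + c + 2 * t → ⊥
  not-regular d≡b+c+2t = [ (λ d≡a+c+2u → <-irrefl (trans (sym d≡a+c+2u) d≡b+c+2t)
                                            (+-mono-<-≤ (+-monoˡ-< c a<b) (*-monoʳ-≤ 2 (<⇒≤ u<t))))
                         , (λ 4ac≤d → <⇒≱ (subst (_< 4 * a * c) (sym d≡b+c+2t) b+c+2t<4ac) 4ac≤d) ]′
                         (s≡p+q+2r⊎4pq≤s {a} {c} {d} {u} {x} {z} 1≤a (<-trans a<b b<c) c<d hu hx hz)

4bc≤d⇒b²≤d×4[1+b]≤d : ∀ {b c d} → 1 ≤ b → b < c → 4 * b * c ≤ d → b * b ≤ d × 4 * suc b ≤ d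
4bc≤d⇒b²≤d×4[1+b]≤d {b} {c} {d} 1≤b b<c 4bc≤d =
  ≤-trans (≤-trans (*-monoʳ-≤ b (<⇒≤ b<c)) bc≤4bc) 4bc≤d , (begin
    4 * suc b   ≤⟨ *-monoʳ-≤ 4 1+b≤bc ⟩
    4 * (b * c) ≡⟨ *-assoc 4 b c ⟨
    4 * b * c   ≤⟨ 4bc≤d ⟩
    d           ∎)
  where
  open ≤-Reasoning
  bc≤4bc : b * c ≤ 4 * b * c
  bc≤4bc = ≤-trans (m≤n*m (b * c) 4) (≤-reflexive (sym (*-assoc 4 b c)))
  1+b≤bc : suc b ≤ b * c
  1+b≤bc = begin
    suc b ≤⟨ +-monoˡ-≤ b 1≤b ⟩
    b + b ≡⟨ solve (b ∷ []) ⟩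
    b * 2 ≤⟨ *-monoʳ-≤ b (≤-trans (s≤s 1≤b) b<c) ⟩
    b * c ∎

-- Orbits of multiplication by x + √(pd)

module _ (p d x : ℕ) where

  halfStep : ℕ × ℕ → ℕ × ℕ
  halfStep (w , χ) = x * w + d * χ , p * w + x * χ

  -- orbit (seed ±ε) k belongs to the exponent 2l with l = k + 1
  orbit : ℕ × ℕ → ℕ → ℕ × ℕ
  orbit s zero    = halfStep s
  orbit s (suc k) = halfStep (halfStep (orbit s k))

  orbitW : ℕ × ℕ → ℕ → ℕ
  orbitW s k = proj₁ (orbit s k)

  Balanced : ℕ × ℕ → Set
  Balanced (w , χ) = p * w ≤ x * χ × d * χ ≤ x * w

  -- the coefficients of (ε √p + √d)(x + √(pd)); the subtractions are exact because p < x < d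
  seed : ∀ {ε} → ε ≡ 1ℤ ⊎ ε ≡ -1ℤ → ℕ × ℕ
  seed (inj₁ _) = x + d , p + x
  seed (inj₂ _) = d ∸ x , x ∸ p

module _ {p d x : ℕ} where

  halfStep-balanced : p * d ≤ x * x → ∀ s → Balanced p d x (halfStep p d x s)
  halfStep-balanced pd≤xx (w , χ) = left , right
    where
    open ≤-Reasoning
    left : p * (x * w + d * χ) ≤ x * (p * w + x * χ)
    left = begin
      p * (x * w + d * χ)     ≡⟨ solve (p ∷ d ∷ x ∷ w ∷ χ ∷ []) ⟩
      x * (p * w) + p * d * χ ≤⟨ +-monoʳ-≤ (x * (p * w)) (*-monoˡ-≤ χ pd≤xx) ⟩
      x * (p * w) + x * x * χ ≡⟨ solve (p ∷ d ∷ x ∷ w ∷ χ ∷ []) ⟩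
      x * (p * w + x * χ)     ∎
    right : d * (p * w + x * χ) ≤ x * (x * w + d * χ)
    right = begin
      d * (p * w + x * χ)     ≡⟨ solve (p ∷ d ∷ x ∷ w ∷ χ ∷ []) ⟩
      p * d * w + x * (d * χ) ≤⟨ +-monoˡ-≤ (x * (d * χ)) (*-monoˡ-≤ w pd≤xx) ⟩
      x * x * w + x * (d * χ) ≡⟨ solve (p ∷ d ∷ x ∷ w ∷ χ ∷ []) ⟩
      x * (x * w + d * χ)     ∎

  orbit-balanced : p * d ≤ x * x → ∀ s k → Balanced p d x (orbit p d x s k)
  orbit-balanced pd≤xx s zero    = halfStep-balanced pd≤xx s
  orbit-balanced pd≤xx s (suc k) = halfStep-balanced pd≤xx (halfStep p d x (orbit p d x s k))

  module _ (hx : p * d + 1 ≡ x * x) where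

    doubleStep-lower : ∀ {w χ} → Balanced p d x (w , χ) →
                       (4 * p * d + 1) * w ≤ proj₁ (halfStep p d x (halfStep p d x (w , χ)))
    doubleStep-lower {w} {χ} (pw≤xχ , _) = begin
      (4 * p * d + 1) * w                          ≡⟨ solve (p ∷ d ∷ w ∷ []) ⟩
      (p * d + 1 + p * d) * w + 2 * d * (p * w)    ≡⟨ cong (λ t → (t + p * d) * w + 2 * d * (p * w)) hx ⟩
      (x * x + p * d) * w + 2 * d * (p * w)        ≤⟨ +-monoʳ-≤ ((x * x + p * d) * w) (*-monoʳ-≤ (2 * d) pw≤xχ) ⟩
      (x * x + p * d) * w + 2 * d * (x * χ)        ≡⟨ solve (p ∷ d ∷ x ∷ w ∷ χ ∷ []) ⟩
      x * (x * w + d * χ) + d * (p * w + x * χ)    ∎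
      where open ≤-Reasoning

    doubleStep-upper : ∀ {w χ} → Balanced p d x (w , χ) →
                       proj₁ (halfStep p d x (halfStep p d x (w , χ))) ≤ (4 * p * d + 3) * w
    doubleStep-upper {w} {χ} (_ , dχ≤xw) = begin
      x * (x * w + d * χ) + d * (p * w + x * χ)    ≡⟨ solve (p ∷ d ∷ x ∷ w ∷ χ ∷ []) ⟩
      (x * x + p * d) * w + 2 * x * (d * χ)        ≤⟨ +-monoʳ-≤ ((x * x + p * d) * w) (*-monoʳ-≤ (2 * x) dχ≤xw) ⟩
      (x * x + p * d) * w + 2 * x * (x * w)        ≡⟨ solve (p ∷ d ∷ x ∷ w ∷ []) ⟩
      (3 * (x * x) + p * d) * w                    ≡⟨ cong (λ t → (3 * t + p * d) * w) hx ⟨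
      (3 * (p * d + 1) + p * d) * w                ≡⟨ solve (p ∷ d ∷ w ∷ []) ⟩
      (4 * p * d + 3) * w                          ∎
      where open ≤-Reasoning

    orbitW-lower : ∀ s k → (4 * p * d + 1) * orbitW p d x s k ≤ orbitW p d x s (suc k)
    orbitW-lower s k = doubleStep-lower (orbit-balanced (subst (p * d ≤_) hx (m≤m+n (p * d) 1)) s k)

    orbitW-upper : ∀ s k → orbitW p d x s (suc k) ≤ (4 * p * d + 3) * orbitW p d x s k
    orbitW-upper s k = doubleStep-upper (orbit-balanced (subst (p * d ≤_) hx (m≤m+n (p * d) 1)) s k)

ι : ℕ × ℕ → ℤ × ℤ
ι (w , χ) = + w , + χ

halfStepℤ-ι : ∀ p d x s → halfStepℤ (+ p) (+ d) (+ x) (ι s) ≡ ι (halfStep p d x s)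
halfStepℤ-ι p d x (w , χ) = cong₂ _,_ (sym (pos-*+* x w d χ)) (sym (pos-*+* p w x χ))

halfStepℤ-seed : ∀ {p d x ε} → p ≤ x → x ≤ d → (±ε : ε ≡ 1ℤ ⊎ ε ≡ -1ℤ) →
                  halfStepℤ (+ p) (+ d) (+ x) (ε , 1ℤ) ≡ ι (seed p d x ±ε)
halfStepℤ-seed {p} {d} {x} _ _ (inj₁ refl) =
  cong₂ _,_ (cong₂ ℤ._+_ (ℤₚ.*-identityʳ (+ x)) (ℤₚ.*-identityʳ (+ d)))
            (cong₂ ℤ._+_ (ℤₚ.*-identityʳ (+ p)) (ℤₚ.*-identityʳ (+ x)))
halfStepℤ-seed {p} {d} {x} p≤x x≤d (inj₂ refl) = cong₂ _,_
  (trans (i*-1+j*1≡j-i (+ x) (+ d)) (sym (pos-∸ x≤d)))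
  (trans (i*-1+j*1≡j-i (+ p) (+ x)) (sym (pos-∸ p≤x)))
  where
  pos-∸ : ∀ {m n} → m ≤ n → + (n ∸ m) ≡ + n ℤ.- + m
  pos-∸ {m} {n} m≤n = trans (sym (ℤₚ.⊖-≥ m≤n)) (sym (ℤₚ.m-n≡m⊖n n m))

PowerEq⇒mixedCoeffs : ∀ {ε p d x W X} k → PowerEq ε p d x W X k →
                      ι (W , X) ≡ mixedCoeffs (+ p) (+ d) ε (powQ (+ p ℤ.* + d) (+ x) k)
PowerEq⇒mixedCoeffs {ε} {p} {d} {x} k eq with powQ (+ p ℤ.* + d) (+ x) k
... | u , v = cong₂ _,_ (proj₁ eq) (proj₂ eq)

module _ {p d x : ℕ} {ε : ℤ} {s : ℕ × ℕ} (s-seed : halfStepℤ (+ p) (+ d) (+ x) (ε , 1ℤ) ≡ ι s) where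
  private
    U : ℤ × ℤ → ℤ × ℤ
    U = halfStepℤ (+ p) (+ d) (+ x)
    C : ℕ → ℤ × ℤ
    C n = mixedCoeffs (+ p) (+ d) ε (powQ (+ p ℤ.* + d) (+ x) n)
    C-suc : ∀ n → C (suc n) ≡ U (C n)
    C-suc n = mixedCoeffs-mulQ (+ p) (+ d) (+ x) ε (powQ (+ p ℤ.* + d) (+ x) n)

  mixedCoeffs-powQ-even : ∀ k → mixedCoeffs (+ p) (+ d) ε (powQ (+ p ℤ.* + d) (+ x) (2 * suc k)) ≡ ι (orbit p d x s k)
  mixedCoeffs-powQ-even zero = begin
    C 2                   ≡⟨ C-suc 1 ⟩
    U (C 1)               ≡⟨ cong U (C-suc 0) ⟩
    U (U (C 0))           ≡⟨ cong (U ∘ U) (mixedCoeffs-one (+ p) (+ d) ε) ⟩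
    U (U (ε , 1ℤ))        ≡⟨ cong U s-seed ⟩
    U (ι s)               ≡⟨ halfStepℤ-ι p d x s ⟩
    ι (halfStep p d x s)  ∎
    where open ≡-Reasoning
  mixedCoeffs-powQ-even (suc k) = begin
    C (2 * suc (suc k))                       ≡⟨ cong C (*-suc 2 (suc k)) ⟩
    C (suc (suc (2 * suc k)))                 ≡⟨ C-suc (suc (2 * suc k)) ⟩
    U (C (suc (2 * suc k)))                   ≡⟨ cong U (C-suc (2 * suc k)) ⟩
    U (U (C (2 * suc k)))                     ≡⟨ cong (U ∘ U) (mixedCoeffs-powQ-even k) ⟩
    U (U (ι (orbit p d x s k)))               ≡⟨ cong U (halfStepℤ-ι p d x (orbit p d x s k)) ⟩
    U (ι (halfStep p d x (orbit p d x s k)))  ≡⟨ halfStepℤ-ι p d x _ ⟩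
    ι (orbit p d x s (suc k))                 ∎
    where open ≡-Reasoning

pell-root-bounds : ∀ {p d x} → 1 ≤ p → p < d → p * d + 1 ≡ x * x → p < x × x < d
pell-root-bounds {p} {d} {x} 1≤p p<d hx = p<x , x<d
  where
  open ≤-Reasoning
  p<x : p < x
  p<x = m*m<n*n⇒m<n (begin-strict
    p * p     ≤⟨ *-monoʳ-≤ p (<⇒≤ p<d) ⟩
    p * d     <⟨ m<m+n (p * d) z<s ⟩
    p * d + 1 ≡⟨ hx ⟩
    x * x     ∎)
  x<d : x < d
  x<d = m*m<n*n⇒m<n (begin-strict
    x * x     ≡⟨ hx ⟨
    p * d + 1 <⟨ +-monoʳ-< (p * d) (≤-<-trans 1≤p p<d) ⟩
    p * d + d ≡⟨ +-comm (p * d) d ⟩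
    suc p * d ≤⟨ *-monoˡ-≤ d p<d ⟩
    d * d     ∎)

+≢±1 : ∀ {W ε} → 1 < W → ε ≡ 1ℤ ⊎ ε ≡ -1ℤ → + W ≢ ε
+≢±1 1<W (inj₁ refl) +W≡1 = <⇒≢ 1<W (sym (ℤₚ.+-injective +W≡1))
+≢±1 _   (inj₂ refl) ()

PowerEq⇒on-orbit : ∀ {p d x W X ε l} → 1 ≤ p → p < d → p * d + 1 ≡ x * x → 1 < W → (±ε : ε ≡ 1ℤ ⊎ ε ≡ -1ℤ) →
                   PowerEq ε p d x W X (2 * l) → ∃ λ k → l ≡ suc k × W ≡ orbitW p d x (seed p d x ±ε) k
PowerEq⇒on-orbit {p} {d} {x} {W} {X} {ε} {zero} _ _ _ 1<W ±ε eq =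
  ⊥-elim (+≢±1 1<W ±ε (cong proj₁ (trans (PowerEq⇒mixedCoeffs {ε} {p} {d} {x} {W} {X} 0 eq)
                                          (mixedCoeffs-one (+ p) (+ d) ε))))
PowerEq⇒on-orbit {p} {d} {x} {W} {X} {ε} {suc k} 1≤p p<d hx _ ±ε eq = k , refl , ℤₚ.+-injective (cong proj₁
  (trans (PowerEq⇒mixedCoeffs {ε} {p} {d} {x} {W} {X} (2 * suc k) eq)
         (mixedCoeffs-powQ-even {p} {d} {x} {ε} (halfStepℤ-seed (<⇒≤ p<x) (<⇒≤ x<d) ±ε) k)))
  where
  p<x = proj₁ (pell-root-bounds {p} {d} {x} 1≤p p<d hx)
  x<d = proj₂ (pell-root-bounds {p} {d} {x} 1≤p p<d hx)

-- The first terms of the orbits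

pell-roots-< : ∀ {a b d x y} → a < b → 1 ≤ d → a * d + 1 ≡ x * x → b * d + 1 ≡ y * y → x < y
pell-roots-< {a} {b} {d} {x} {y} a<b 1≤d hx hy = m*m<n*n⇒m<n (begin-strict
  x * x     ≡⟨ hx ⟨
  a * d + 1 <⟨ +-monoˡ-< 1 (*-monoˡ-< d {{>-nonZero 1≤d}} a<b) ⟩
  b * d + 1 ≡⟨ hy ⟩
  y * y     ∎)
  where open ≤-Reasoning

x+b<y+a : ∀ {a b d x y} → a * d + 1 ≡ x * x → b * d + 1 ≡ y * y → a < b → x + y < d → x + b < y + a
x+b<y+a {a} {b} {d} {x} {y} hx hy a<b x+y<d = ≰⇒> λ y+a≤x+b → <⇒≱ (rearrangement-< a<b x+y<d) (swapped y+a≤x+b)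
  where
  open ≤-Reasoning
  swapped : y + a ≤ x + b → a * (x + y) + b * d ≤ a * d + b * (x + y)
  swapped y+a≤x+b = +-cancelˡ-≤ (x * y + 1) _ _ (begin
    x * y + 1 + (a * (x + y) + b * d)  ≡⟨ solve (a ∷ b ∷ d ∷ x ∷ y ∷ []) ⟩
    x * y + (b * d + 1) + a * (x + y)  ≡⟨ cong (λ t → x * y + t + a * (x + y)) hy ⟩
    x * y + y * y + a * (x + y)        ≡⟨ solve (a ∷ x ∷ y ∷ []) ⟩
    (y + a) * (x + y)                  ≤⟨ *-monoˡ-≤ (x + y) y+a≤x+b ⟩
    (x + b) * (x + y)                  ≡⟨ solve (b ∷ x ∷ y ∷ []) ⟩
    x * x + x * y + b * (x + y)        ≡⟨ cong (λ t → t + x * y + b * (x + y)) hx ⟨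
    a * d + 1 + x * y + b * (x + y)    ≡⟨ solve (a ∷ b ∷ d ∷ x ∷ y ∷ []) ⟩
    x * y + 1 + (a * d + b * (x + y))  ∎)

x+y<d : ∀ {a b d x y} → a < b → a * d + 1 ≡ x * x → b * d + 1 ≡ y * y → 4 * suc b ≤ d → x + y < d
x+y<d {a} {b} {d} {x} {y} a<b hx hy 4[1+b]≤d = begin-strict
  x + y ≤⟨ +-monoˡ-≤ y (<⇒≤ (pell-roots-< {a} {b} {d} {x} {y} a<b (<⇒≤ 1<d) hx hy)) ⟩
  y + y ≡⟨ cong (_+_ y) (+-identityʳ y) ⟨
  2 * y <⟨ m*m<n*n⇒m<n 4y²<d² ⟩
  d     ∎
  where
  open ≤-Reasoning
  1<d : 1 < d
  1<d = ≤-trans (s≤s (s≤s z≤n)) (≤-trans (m≤m*n 4 (suc b)) 4[1+b]≤d)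
  4y²<d² : 2 * y * (2 * y) < d * d
  4y²<d² = begin-strict
    2 * y * (2 * y) ≡⟨ solve (y ∷ []) ⟩
    4 * (y * y)     ≡⟨ cong (4 *_) hy ⟨
    4 * (b * d + 1) <⟨ *-monoʳ-< 4 (+-monoʳ-< (b * d) 1<d) ⟩
    4 * (b * d + d) ≡⟨ solve (b ∷ d ∷ []) ⟩
    4 * suc b * d   ≤⟨ *-monoˡ-≤ d 4[1+b]≤d ⟩
    d * d           ∎

4ad+3≤4bd+1 : ∀ {a b d} → a < b → 1 ≤ d → 4 * a * d + 3 ≤ 4 * b * d + 1
4ad+3≤4bd+1 {a} {b} {d} a<b 1≤d = begin
  4 * a * d + 3     ≤⟨ +-monoʳ-≤ (4 * a * d) (≤-trans (m≤m+n 3 1) (*-monoʳ-≤ 4 1≤d)) ⟩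
  4 * a * d + 4 * d ≡⟨ solve (a ∷ d ∷ []) ⟩
  4 * suc a * d     ≤⟨ *-monoˡ-≤ d (*-monoʳ-≤ 4 a<b) ⟩
  4 * b * d         ≤⟨ m≤m+n (4 * b * d) 1 ⟩
  4 * b * d + 1     ∎
  where open ≤-Reasoning

[4bd+3]²≤[4d]³ : ∀ {b d} → 1 ≤ b → b * b ≤ d → (4 * b * d + 3) ^ 2 ≤ (4 * d) ^ 3
[4bd+3]²≤[4d]³ {b} {d} 1≤b b²≤d = begin
  (4 * b * d + 3) ^ 2                              ≡⟨ cong ((4 * b * d + 3) *_) (*-identityʳ (4 * b * d + 3)) ⟩
  (4 * b * d + 3) * (4 * b * d + 3)                ≤⟨ *-mono-≤ 4bd+3≤[4b+3]d 4bd+3≤[4b+3]d ⟩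
  (4 * b + 3) * d * ((4 * b + 3) * d)              ≡⟨ [m*n]*[m*n]≡[m*m]*[n*n] (4 * b + 3) d ⟩
  (4 * b + 3) * (4 * b + 3) * (d * d)              ≤⟨ *-monoˡ-≤ (d * d) [4b+3]²≤64d ⟩
  64 * d * (d * d)                                 ≡⟨ solve (d ∷ []) ⟩
  4 * d * (4 * d * (4 * d * 1))                    ∎
  where
  open ≤-Reasoning
  1≤d : 1 ≤ d
  1≤d = ≤-trans (*-mono-≤ 1≤b 1≤b) b²≤d
  b≤d : b ≤ d
  b≤d = ≤-trans (≤-trans (≤-reflexive (sym (*-identityʳ b))) (*-monoʳ-≤ b 1≤b)) b²≤d
  4bd+3≤[4b+3]d : 4 * b * d + 3 ≤ (4 * b + 3) * d
  4bd+3≤[4b+3]d = begin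
    4 * b * d + 3     ≤⟨ +-monoʳ-≤ (4 * b * d) (*-monoʳ-≤ 3 1≤d) ⟩
    4 * b * d + 3 * d ≡⟨ solve (b ∷ d ∷ []) ⟩
    (4 * b + 3) * d   ∎
  [4b+3]²≤64d : (4 * b + 3) * (4 * b + 3) ≤ 64 * d
  [4b+3]²≤64d = begin
    (4 * b + 3) * (4 * b + 3)         ≡⟨ solve (b ∷ []) ⟩
    16 * (b * b) + 24 * b + 9         ≤⟨ +-mono-≤ (+-mono-≤ (*-monoʳ-≤ 16 b²≤d) (*-monoʳ-≤ 24 b≤d))
                                                  (≤-trans (m≤m+n 9 15) (*-monoʳ-≤ 24 1≤d)) ⟩
    16 * d + 24 * d + 24 * d          ≡⟨ solve (d ∷ []) ⟩
    64 * d                            ∎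

seed⁻-first-term : ∀ {p d x} → p ≤ x → x ≤ d → x * (d ∸ x) + d * (x ∸ p) + (x * x + d * p) ≡ x * d + d * x
seed⁻-first-term {p} {d} {x} p≤x x≤d = begin
  x * (d ∸ x) + d * (x ∸ p) + (x * x + d * p)  ≡⟨ +-interchange (x * (d ∸ x)) (d * (x ∸ p)) (x * x) (d * p) ⟩
  x * (d ∸ x) + x * x + (d * (x ∸ p) + d * p)  ≡⟨ cong₂ _+_ (*-distribˡ-+ x (d ∸ x) x) (*-distribˡ-+ d (x ∸ p) p) ⟨
  x * (d ∸ x + x) + d * (x ∸ p + p)            ≡⟨ cong₂ (λ i j → x * i + d * j) (m∸n+n≡m x≤d) (m∸n+n≡m p≤x) ⟩
  x * d + d * x                                ∎
  where open ≡-Reasoning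

module _ {p d x : ℕ} (1≤p : 1 ≤ p) (p<d : p < d) (hx : p * d + 1 ≡ x * x) {ε : ℤ} (±ε : ε ≡ 1ℤ ⊎ ε ≡ -1ℤ) where
  private
    p<x = proj₁ (pell-root-bounds {p} {d} {x} 1≤p p<d hx)
    x<d = proj₂ (pell-root-bounds {p} {d} {x} 1≤p p<d hx)
    instance
      d≢0 : NonZero d
      d≢0 = >-nonZero (≤-<-trans z≤n p<d)

  d≤orbitW₀ : d ≤ orbitW p d x (seed p d x ±ε) 0
  d≤orbitW₀ = begin
    d                         ≡⟨ *-identityʳ d ⟨
    d * 1                     ≤⟨ *-monoʳ-≤ d (1≤proj₂ ±ε) ⟩
    d * proj₂ s               ≤⟨ m≤n+m (d * proj₂ s) (x * proj₁ s) ⟩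
    x * proj₁ s + d * proj₂ s ∎
    where
    open ≤-Reasoning
    s = seed p d x ±ε
    1≤proj₂ : (±ε : ε ≡ 1ℤ ⊎ ε ≡ -1ℤ) → 1 ≤ proj₂ (seed p d x ±ε)
    1≤proj₂ (inj₁ _) = ≤-trans 1≤p (m≤m+n p x)
    1≤proj₂ (inj₂ _) = m<n⇒0<n∸m p<x

  orbitW₀<4dd : orbitW p d x (seed p d x ±ε) 0 < 4 * d * d
  orbitW₀<4dd = <-≤-trans (below ±ε) (≤-reflexive 2d[d+d]≡4dd)
    where
    open ≤-Reasoning
    2d[d+d]≡4dd : d * (d + d) + d * (d + d) ≡ 4 * d * d
    2d[d+d]≡4dd = solve (d ∷ [])
    below : (±ε : ε ≡ 1ℤ ⊎ ε ≡ -1ℤ) → orbitW p d x (seed p d x ±ε) 0 < d * (d + d) + d * (d + d)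
    below (inj₁ _) = +-mono-<-≤ (*-mono-< x<d (+-monoˡ-< d x<d)) (*-monoʳ-≤ d (+-mono-≤ (<⇒≤ p<d) (<⇒≤ x<d)))
    below (inj₂ _) = begin-strict
      x * (d ∸ x) + d * (x ∸ p)                     ≤⟨ m≤m+n _ (x * x + d * p) ⟩
      x * (d ∸ x) + d * (x ∸ p) + (x * x + d * p)   ≡⟨ seed⁻-first-term (<⇒≤ p<x) (<⇒≤ x<d) ⟩
      x * d + d * x                                 <⟨ +-mono-<-≤ (*-monoˡ-< d x<d) (*-monoʳ-≤ d (<⇒≤ x<d)) ⟩
      d * d + d * d                                 ≤⟨ +-mono-≤ (*-monoʳ-≤ d (m≤m+n d d)) (*-monoʳ-≤ d (m≤m+n d d)) ⟩
      d * (d + d) + d * (d + d)                     ∎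

seed⁻-first-term-shifted : ∀ {p q d x W} → p * d + 1 ≡ x * x → W + (x * x + d * p) ≡ x * d + d * x →
                           W + (2 * (p * d) + 2 * (q * d) + 1) ≡ 2 * d * (x + q)
seed⁻-first-term-shifted {p} {q} {d} {x} {W} hx eq = begin
  W + (2 * (p * d) + 2 * (q * d) + 1)  ≡⟨ solve (p ∷ q ∷ d ∷ W ∷ []) ⟩
  W + (p * d + 1 + d * p) + 2 * (q * d) ≡⟨ cong (λ t → W + (t + d * p) + 2 * (q * d)) hx ⟩
  W + (x * x + d * p) + 2 * (q * d)     ≡⟨ cong (_+ 2 * (q * d)) eq ⟩
  x * d + d * x + 2 * (q * d)           ≡⟨ solve (q ∷ d ∷ x ∷ []) ⟩
  2 * d * (x + q)                       ∎
  where open ≡-Reasoning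

first-terms-< : ∀ {a b d x y ε} → 1 ≤ a → a < b → b < d → a * d + 1 ≡ x * x → b * d + 1 ≡ y * y → x + y < d →
                (±ε : ε ≡ 1ℤ ⊎ ε ≡ -1ℤ) → orbitW a d x (seed a d x ±ε) 0 < orbitW b d y (seed b d y ±ε) 0
first-terms-< {a} {b} {d} {x} {y} 1≤a a<b b<d hx hy x+y<d (inj₁ _) =
  +-mono-<-≤ (*-mono-< x<y (+-monoˡ-< d x<y)) (*-monoʳ-≤ d (+-mono-≤ (<⇒≤ a<b) (<⇒≤ x<y)))
  where
  x<y = pell-roots-< {a} {b} {d} {x} {y} a<b (≤-trans 1≤a (<⇒≤ (<-trans a<b b<d))) hx hy
first-terms-< {a} {b} {d} {x} {y} 1≤a a<b b<d hx hy x+y<d (inj₂ _) = +-cancelʳ-< K Wa Wb (begin-strict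
  Wa + K                                ≡⟨ Wa-shifted ⟩
  2 * d * (x + b)                       <⟨ *-monoʳ-< (2 * d) {{>-nonZero (≤-trans 1≤d (m≤m+n d (d + 0)))}}
                                                     (x+b<y+a hx hy a<b x+y<d) ⟩
  2 * d * (y + a)                       ≡⟨ Wb-shifted ⟨
  Wb + (2 * (b * d) + 2 * (a * d) + 1)  ≡⟨ cong (λ t → Wb + (t + 1)) (+-comm (2 * (b * d)) (2 * (a * d))) ⟩
  Wb + K                                ∎)
  where
  open ≤-Reasoning
  1≤b = ≤-trans 1≤a (<⇒≤ a<b)
  1≤d = ≤-trans 1≤b (<⇒≤ b<d)
  a<x = proj₁ (pell-root-bounds {a} {d} {x} 1≤a (<-trans a<b b<d) hx)
  x<d = proj₂ (pell-root-bounds {a} {d} {x} 1≤a (<-trans a<b b<d) hx)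
  b<y = proj₁ (pell-root-bounds {b} {d} {y} 1≤b b<d hy)
  y<d = proj₂ (pell-root-bounds {b} {d} {y} 1≤b b<d hy)
  Wa = x * (d ∸ x) + d * (x ∸ a)
  Wb = y * (d ∸ y) + d * (y ∸ b)
  K = 2 * (a * d) + 2 * (b * d) + 1
  Wa-shifted = seed⁻-first-term-shifted {a} {b} {d} {x} {Wa} hx (seed⁻-first-term (<⇒≤ a<x) (<⇒≤ x<d))
  Wb-shifted = seed⁻-first-term-shifted {b} {a} {d} {y} {Wb} hy (seed⁻-first-term (<⇒≤ b<y) (<⇒≤ y<d))

orbit-exponents : ∀ {a b d x y W l m ε} → 1 ≤ a → a < b → b * b ≤ d → 4 * suc b ≤ d →
                  a * d + 1 ≡ x * x → b * d + 1 ≡ y * y → (±ε : ε ≡ 1ℤ ⊎ ε ≡ -1ℤ) →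
                  (∃ λ k → l ≡ suc k × W ≡ orbitW a d x (seed a d x ±ε) k) →
                  (∃ λ k → m ≡ suc k × W ≡ orbitW b d y (seed b d y ±ε) k) →
                  2 * l ≤ 3 * m × (m ≢ 0 → m < l)
orbit-exponents {a} {b} {d} {x} {y} {W} 1≤a a<b b²≤d 4[1+b]≤d hx hy ±ε (l , refl , W≡fa) (m , refl , W≡fb) =
  growth-gap {4 * d} {4 * b * d + 3} {d} {fb 0} ([4bd+3]²≤[4d]³ 1≤b b²≤d) (orbitW₀<4dd 1≤b b<d hy ±ε) lower upper ,
  λ _ → s≤s (meeting-index-< {fa} {fb} {4 * b * d + 1} ⦃ >-nonZero (m≤n+m 1 (4 * b * d)) ⦄
                             fa-step (orbitW-lower {b} {d} {y} hy sb) fa₀<fb₀ (trans (sym W≡fa) W≡fb))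
  where
  sa = seed a d x ±ε
  sb = seed b d y ±ε
  fa = orbitW a d x sa
  fb = orbitW b d y sb
  1≤b = ≤-trans 1≤a (<⇒≤ a<b)
  b<d : b < d
  b<d = ≤-trans (m≤n*m (suc b) 4) 4[1+b]≤d
  a<d = <-trans a<b b<d
  1≤d = ≤-trans 1≤a (<⇒≤ a<d)
  fa₀<fb₀ : fa 0 < fb 0
  fa₀<fb₀ = first-terms-< 1≤a a<b b<d hx hy (x+y<d {a} {b} {d} {x} {y} a<b hx hy 4[1+b]≤d) ±ε
  fa-step : ∀ k → fa (suc k) ≤ (4 * b * d + 1) * fa k
  fa-step k = ≤-trans (orbitW-upper {a} {d} {x} hx sa k) (*-monoˡ-≤ (fa k) (4ad+3≤4bd+1 a<b 1≤d))
  lower : (4 * d) ^ l * d ≤ W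
  lower = begin
    (4 * d) ^ l * d            ≤⟨ *-mono-≤ (^-monoˡ-≤ l 4d≤4ad+1) (d≤orbitW₀ 1≤a a<d hx ±ε) ⟩
    (4 * a * d + 1) ^ l * fa 0 ≤⟨ geometric-lower-bound fa (orbitW-lower {a} {d} {x} hx sa) l ⟩
    fa l                       ≡⟨ W≡fa ⟨
    W                          ∎
    where
    open ≤-Reasoning
    4d≤4ad+1 : 4 * d ≤ 4 * a * d + 1
    4d≤4ad+1 = ≤-trans (*-monoˡ-≤ d (*-monoʳ-≤ 4 1≤a)) (m≤m+n (4 * a * d) 1)
  upper : W ≤ (4 * b * d + 3) ^ m * fb 0
  upper = subst (_≤ (4 * b * d + 3) ^ m * fb 0) (sym W≡fb)
                (geometric-upper-bound fb (orbitW-upper {b} {d} {y} hy sb) m)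

lemma6p3 : (a b c d e : ℕ) →
           DiophantineTuple (a ∷ b ∷ c ∷ d ∷ e ∷ []) →
           a < b → b < c → c < d → d < e →
           (x y z X Y Z W : ℕ) →
           0 < x → 0 < y → 0 < z → 0 < X → 0 < Y → 0 < Z → 0 < W →
           a * d + 1 ≡ x * x → b * d + 1 ≡ y * y → c * d + 1 ≡ z * z →
           a * e + 1 ≡ X * X → b * e + 1 ≡ Y * Y → c * e + 1 ≡ Z * Z →
           d * e + 1 ≡ W * W →
           (ε : ℤ) → (ε ≡ 1ℤ ⊎ ε ≡ -1ℤ) →
           (l m n : ℕ) →
           PowerEq ε a d x W X (2 * l) →
           PowerEq ε b d y W Y (2 * m) →
           PowerEq ε c d z W Z (2 * n) →
           (2 * l ≤ 3 * m) × (m ≢ 0 → m < l)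
lemma6p3 a b c d e (positive , _ , pair-square) a<b b<c c<d d<e x y z X Y Z W _ _ _ _ _ _ _ hx hy hz _ _ _ hW
         ε ±ε l m _ W-from-a W-from-b _ =
  orbit-exponents 1≤a a<b (proj₁ d-large) (proj₂ d-large) hx hy ±ε
    (PowerEq⇒on-orbit {a} {d} {x} {W} {X} 1≤a (<-trans a<b b<d) hx 1<W ±ε W-from-a)
    (PowerEq⇒on-orbit {b} {d} {y} {W} {Y} 1≤b b<d hy 1<W ±ε W-from-b)
  where
  1≤a = All.head positive
  1≤b = ≤-trans 1≤a (<⇒≤ a<b)
  b<d = <-trans b<c c<d
  1≤d = ≤-trans 1≤b (<⇒≤ b<d)
  bc+1-square = pair-square (there (here refl)) (there (there (here refl))) (<⇒≢ b<c)
  ac+1-square = pair-square (here refl) (there (there (here refl))) (<⇒≢ (<-trans a<b b<c))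
  d-large = 4bc≤d⇒b²≤d×4[1+b]≤d 1≤b b<c
    (4bc≤d 1≤a a<b b<c c<d ac+1-square bc+1-square (x , sym hx) (y , sym hy) (z , sym hz))
  1<W : 1 < W
  1<W = m*m<n*n⇒m<n (subst (1 <_) hW (+-monoˡ-≤ 1 (*-mono-≤ 1≤d (≤-trans 1≤d (<⇒≤ d<e)))))
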